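{- Let $n\ge3$ and consider the natural action of the alternating group $\mathrm{Alt}(n)$ on $X=\{1,\ldots,n\}$, which is sharply $(n-2)$-transitive. This action can be sequenced if and only if $n$ is even. Moreover, when $n$ is even, every enumeration of $X$ is a sequencing of this action.
   Context: For a group $G$ acting on a finite set $X$, $X^{(m)}$ denotes the set of ordered $m$-tuples of distinct elements of $X$, with coordinatewise $G$-action. The action is sharply $k$-transitive if for all $\mathbf{u},\mathbf{v}\in X^{(k)}$ there is exactly one $g\in G$ with $g\mathbf{u}=\mathbf{v}$. A sequencing of a sharply $k$-transitive action of $G$ on an $n$-set $X$ is an enumeration $(x_1,\ldots,x_n)$ of all elements of $X$ such that the $n-k$ tuples $(x_i,x_{i+1},\ldots,x_{i+k})$, $1\le i\le n-k$, lie in pairwise distinct $G$-orbits on $X^{(k+1)}$. The action "can be sequenced" if a sequencing exists. -}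

module Defs where

open import Data.Nat using (ℕ; zero; suc; _+_; _<_; _≤_)
open import Data.Nat.Divisibility using (_∣_)
open import Data.Fin using (Fin; toℕ; fromℕ<)
open import Data.Fin.Properties using (_<?_)
open import Data.Fin.Permutation using (Permutation′; _⟨$⟩ʳ_)
open import Data.List using (List; map; allFin)
open import Data.Nat.ListAction using (sum)
open import Data.Bool using (if_then_else_; _∧_)
open import Data.Product using (Σ; _×_)
open import Relation.Nullary using (¬_)
open import Relation.Nullary.Decidable using (⌊_⌋)
open import Relation.Binary.PropositionalEquality using (_≡_; _≢_)

inversions : {n : ℕ} → Permutation′ n → ℕ
inversions {n} π =
  sum (map (λ i → sum (map (λ j →
         if ⌊ i <? j ⌋ ∧ ⌊ (π ⟨$⟩ʳ j) <? (π ⟨$⟩ʳ i) ⌋ then 1 else 0)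
       (allFin n))) (allFin n))

IsAlt : {n : ℕ} → Permutation′ n → Set
IsAlt π = 2 ∣ inversions π

-- For an enumeration x (a bijection Fin n → Fin n, x i = (i+1)-th element)
-- and window length k+1: the windows starting at (0-based) positions i and j,
-- (x_i,…,x_{i+k}) and (x_j,…,x_{j+k}), lie in the same G-orbit on X^{(k+1)}.
SameOrbitWindows : {n : ℕ} (G : Permutation′ n → Set) (k : ℕ)
                   (x : Permutation′ n) (i j : ℕ) → Set
SameOrbitWindows {n} G k x i j =
  Σ (Permutation′ n) λ g → G g ×
    (∀ (t : ℕ) → t ≤ k → (p : i + t < n) (q : j + t < n) →
       g ⟨$⟩ʳ (x ⟨$⟩ʳ fromℕ< p) ≡ x ⟨$⟩ʳ fromℕ< q)

IsSequencing : {n : ℕ} (G : Permutation′ n → Set) (k : ℕ)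
               (x : Permutation′ n) → Set
IsSequencing {n} G k x =
  ∀ (i j : ℕ) → i + k < n → j + k < n → i ≢ j → ¬ SameOrbitWindows G k x i j

CanBeSequenced : (n : ℕ) (G : Permutation′ n → Set) (k : ℕ) → Set
CanBeSequenced n G k = Σ (Permutation′ n) λ x → IsSequencing G k x

-- With k = n − 2 there are only two windows, x₀…x_{n−2} and x₁…x_{n−1}. A permutation
-- carrying one onto the other must carry the one remaining point along too, so it is
-- x c x⁻¹ or x c⁻¹ x⁻¹ for the n-cycle c, whose inversion number is n − 1. Thus such a
-- permutation is even exactly when n is odd, whatever the enumeration x.
-- Parity of inversions is multiplicative because "f reverses the order of i and j" is
-- additive over composition (f ∘ g reverses (i, j) iff exactly one of g on (i, j) and f on
-- (g i, g j) does), and the number of reversed pairs is invariant under relabelling the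
-- points by a permutation, being half the number of reversed ordered pairs.
module Submission where

open import Defs
open import Function.Definitions using (Injective)
open import Data.Bool using (Bool; true; false; not; _∧_; _xor_; if_then_else_)
open import Data.Bool.Properties using (not-involutive)
open import Data.Fin as Fin using (Fin; zero; suc; toℕ; fromℕ; fromℕ<; inject₁)
open import Data.Fin.Properties
  using (_<?_; <-cmp; <-asym; <⇒≢; toℕ<n; toℕ-injective; toℕ-fromℕ; toℕ-fromℕ<; fromℕ<-toℕ; toℕ-inject₁)
open import Data.Fin.Permutation
  using (Permutation′; _⟨$⟩ʳ_; _⟨$⟩ˡ_; _≈_; inverseˡ; inverseʳ; permutation; _∘ₚ_; flip; id)
open import Data.List using (map; allFin; tabulate)
open import Data.List.Properties using (map-tabulate)
open import Data.Nat using (ℕ; zero; suc; _+_; _*_; _<_; _≤_; _∸_; z≤n; s≤s; s≤s⁻¹; z<s; s<s⁻¹; parity)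
import Data.Nat.ListAction as List
import Data.Nat.Properties as ℕ
open import Data.Nat.Divisibility using (_∣_; divides)
open import Data.Parity as ℙ using (Parity; 0ℙ; 1ℙ; _⁻¹)
import Data.Parity.Properties as ℙ
open import Data.Product using (Σ; _×_; _,_)
open import Function using (_∘_)
open import Function.Bundles using (_⇔_; mk⇔; Injection; Equivalence)
open import Function.Properties.Inverse using (Inverse⇒Injection)
open import Relation.Binary.PropositionalEquality
open import Relation.Binary.Definitions using (tri<; tri≈; tri>)
open import Relation.Nullary using (¬_; yes; no; contradiction)
open import Relation.Nullary.Decidable using (⌊_⌋; isYes≗does; dec-true; dec-false)
open import Algebra.Properties.CommutativeMonoid.Sum ℕ.+-0-commutativeMonoid
  using (sum; sum-syntax; sum-replicate-zero; ∑-distrib-+; ∑-comm; ∑-permute; sum-cong-≗)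
import Algebra.Properties.CommutativeMonoid.Sum ℙ.+-0-commutativeMonoid as ℙΣ

private
  variable
    n : ℕ
    i j : Fin n

2∣⇒parity≡0ℙ : 2 ∣ n → parity n ≡ 0ℙ
2∣⇒parity≡0ℙ (divides q refl) = trans (ℙ.*-homo-* q 2) (ℙ.*-zeroʳ (parity q))

parity≡0ℙ⇒2∣ : ∀ n → parity n ≡ 0ℙ → 2 ∣ n
parity≡0ℙ⇒2∣ zero          _ = divides 0 refl
parity≡0ℙ⇒2∣ (suc (suc n)) e with divides q eq ← parity≡0ℙ⇒2∣ n e = divides (suc q) (cong (2 +_) eq)

parity-suc : ∀ n → parity (suc n) ≡ parity n ⁻¹
parity-suc n = sym (ℙ.⁻¹-selfInverse (ℙ.suc-homo-⁻¹ n))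

parity-∑ : (f : Fin n → ℕ) → parity (sum f) ≡ ℙΣ.sum (parity ∘ f)
parity-∑ {zero}  f = refl
parity-∑ {suc n} f = trans (ℙ.+-homo-+ (f zero) _) (cong (parity (f zero) ℙ.+_) (parity-∑ (f ∘ suc)))

⟦_⟧ : Bool → ℕ
⟦ b ⟧ = if b then 1 else 0

infix 7 _<ᵇ_
_<ᵇ_ : Fin n → Fin n → Bool
i <ᵇ j = ⌊ i <? j ⌋

<ᵇ-true : i Fin.< j → i <ᵇ j ≡ true
<ᵇ-true {i = i} {j} i<j = trans (isYes≗does (i <? j)) (dec-true (i <? j) i<j)

<ᵇ-false : ¬ i Fin.< j → i <ᵇ j ≡ false
<ᵇ-false {i = i} {j} i≮j = trans (isYes≗does (i <? j)) (dec-false (i <? j) i≮j)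

<ᵇ-flip : i ≢ j → i <ᵇ j ≡ not (j <ᵇ i)
<ᵇ-flip {i = i} {j} i≢j with <-cmp i j
... | tri< i<j _ j≮i rewrite <ᵇ-true i<j | <ᵇ-false j≮i = refl
... | tri≈ _ i≡j _   = contradiction i≡j i≢j
... | tri> i≮j _ j<i rewrite <ᵇ-false i≮j | <ᵇ-true j<i = refl

<ᵇ-irrefl : (i : Fin n) → i <ᵇ i ≡ false
<ᵇ-irrefl i = <ᵇ-false (ℕ.<-irrefl refl)

count< : (Fin n → Fin n → Bool) → ℕ
count< {n} R = ∑[ i < n ] ∑[ j < n ] ⟦ i <ᵇ j ∧ R i j ⟧

inversionCount : (Fin n → Fin n) → ℕ
inversionCount f = count< (λ i j → f j <ᵇ f i)

sign : Permutation′ n → Parity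
sign π = parity (inversionCount (π ⟨$⟩ʳ_))

sum-tabulate : (f : Fin n → ℕ) → List.sum (tabulate f) ≡ sum f
sum-tabulate {zero}  f = refl
sum-tabulate {suc n} f = cong (f zero +_) (sum-tabulate (f ∘ suc))

sum-map-allFin : (f : Fin n → ℕ) → List.sum (map f (allFin n)) ≡ sum f
sum-map-allFin {n} f = trans (cong List.sum (map-tabulate Function.id f)) (sum-tabulate f)

inversions≡inversionCount : (π : Permutation′ n) → inversions π ≡ inversionCount (π ⟨$⟩ʳ_)
inversions≡inversionCount {n} π =
  trans (sum-map-allFin (λ i → List.sum (map (entry i) (allFin n))))
        (sum-cong-≗ (λ i → sum-map-allFin (entry i)))
  where
  entry : Fin n → Fin n → ℕ
  entry i j = ⟦ i <ᵇ j ∧ (π ⟨$⟩ʳ j) <ᵇ (π ⟨$⟩ʳ i) ⟧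

IsAlt⇔sign≡0ℙ : (π : Permutation′ n) → IsAlt π ⇔ sign π ≡ 0ℙ
IsAlt⇔sign≡0ℙ π = mk⇔
  (λ 2∣inv → trans (cong parity (sym (inversions≡inversionCount π))) (2∣⇒parity≡0ℙ 2∣inv))
  (λ sign≡0 → parity≡0ℙ⇒2∣ _ (trans (cong parity (inversions≡inversionCount π)) sign≡0))

∑∑⟦⟧≡2*count< : (R : Fin n → Fin n → Bool) →
                 (∀ i j → R i j ≡ R j i) → (∀ i → R i i ≡ false) →
                 ∑[ i < n ] ∑[ j < n ] ⟦ R i j ⟧ ≡ 2 * count< R
∑∑⟦⟧≡2*count< {n} R R-sym R-irrefl = begin
  ∑[ i < n ] ∑[ j < n ] ⟦ R i j ⟧
    ≡⟨ sum-cong-≗ (λ i → sum-cong-≗ (split i)) ⟩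
  ∑[ i < n ] ∑[ j < n ] (below i j + above i j)
    ≡⟨ sum-cong-≗ (λ i → ∑-distrib-+ (below i) (above i)) ⟩
  ∑[ i < n ] (∑[ j < n ] below i j + ∑[ j < n ] above i j)
    ≡⟨ ∑-distrib-+ (λ i → ∑[ j < n ] below i j) (λ i → ∑[ j < n ] above i j) ⟩
  count< R + ∑[ i < n ] ∑[ j < n ] above i j
    ≡⟨ cong (count< R +_) (∑-comm above) ⟩
  count< R + ∑[ j < n ] ∑[ i < n ] above i j
    ≡⟨ cong (count< R +_) (sum-cong-≗ (λ j → sum-cong-≗ (λ i → cong (λ b → ⟦ j <ᵇ i ∧ b ⟧) (R-sym i j)))) ⟩
  count< R + count< R
    ≡⟨ cong (count< R +_) (sym (ℕ.+-identityʳ _)) ⟩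
  2 * count< R ∎
  where
  open ≡-Reasoning
  below above : Fin n → Fin n → ℕ
  below i j = ⟦ i <ᵇ j ∧ R i j ⟧
  above i j = ⟦ j <ᵇ i ∧ R i j ⟧
  split : ∀ i j → ⟦ R i j ⟧ ≡ below i j + above i j
  split i j with <-cmp i j
  ... | tri< i<j _ j≮i rewrite <ᵇ-true i<j | <ᵇ-false j≮i = sym (ℕ.+-identityʳ _)
  ... | tri≈ _ refl _  rewrite R-irrefl i | <ᵇ-irrefl i = refl
  ... | tri> i≮j _ j<i rewrite <ᵇ-false i≮j | <ᵇ-true j<i = refl

count<-permute : (R : Fin n → Fin n → Bool) →
                 (∀ i j → R i j ≡ R j i) → (∀ i → R i i ≡ false) →
                 (τ : Permutation′ n) →
                 count< (λ i j → R (τ ⟨$⟩ʳ i) (τ ⟨$⟩ʳ j)) ≡ count< R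
count<-permute {n} R R-sym R-irrefl τ = ℕ.*-cancelˡ-≡ _ _ 2 (begin
  2 * count< Rτ                       ≡⟨ sym (∑∑⟦⟧≡2*count< Rτ (λ i j → R-sym (τ ⟨$⟩ʳ i) _) (R-irrefl ∘ (τ ⟨$⟩ʳ_))) ⟩
  ∑[ i < n ] ∑[ j < n ] ⟦ Rτ i j ⟧  ≡⟨ sym ∑∑-permute ⟩
  ∑[ i < n ] ∑[ j < n ] ⟦ R i j ⟧   ≡⟨ ∑∑⟦⟧≡2*count< R R-sym R-irrefl ⟩
  2 * count< R                        ∎)
  where
  open ≡-Reasoning
  Rτ : Fin n → Fin n → Bool
  Rτ i j = R (τ ⟨$⟩ʳ i) (τ ⟨$⟩ʳ j)
  ∑∑-permute : ∑[ i < n ] ∑[ j < n ] ⟦ R i j ⟧ ≡ ∑[ i < n ] ∑[ j < n ] ⟦ Rτ i j ⟧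
  ∑∑-permute = trans (∑-permute (λ a → ∑[ b < n ] ⟦ R a b ⟧) τ)
                     (sum-cong-≗ (λ i → ∑-permute (λ b → ⟦ R (τ ⟨$⟩ʳ i) b ⟧) τ))

parity-⟦∧xor⟧ : ∀ a x y → parity ⟦ a ∧ (x xor y) ⟧ ≡ parity ⟦ a ∧ x ⟧ ℙ.+ parity ⟦ a ∧ y ⟧
parity-⟦∧xor⟧ false x     y     = refl
parity-⟦∧xor⟧ true  false y     = refl
parity-⟦∧xor⟧ true  true  false = refl
parity-⟦∧xor⟧ true  true  true  = refl

parity-count<-xor : (R S : Fin n → Fin n → Bool) →
                    parity (count< (λ i j → R i j xor S i j)) ≡ parity (count< R) ℙ.+ parity (count< S)
parity-count<-xor {n} R S = begin
  parity (count< (λ i j → R i j xor S i j))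
    ≡⟨ parity-∑∑ (λ i j → ⟦ i <ᵇ j ∧ (R i j xor S i j) ⟧) ⟩
  ℙΣ.sum (λ i → ℙΣ.sum (λ j → parity ⟦ i <ᵇ j ∧ (R i j xor S i j) ⟧))
    ≡⟨ ℙΣ.sum-cong-≗ (λ i → ℙΣ.sum-cong-≗ (λ j → parity-⟦∧xor⟧ (i <ᵇ j) (R i j) (S i j))) ⟩
  ℙΣ.sum (λ i → ℙΣ.sum (λ j → pR i j ℙ.+ pS i j))
    ≡⟨ ℙΣ.sum-cong-≗ (λ i → ℙΣ.∑-distrib-+ (pR i) (pS i)) ⟩
  ℙΣ.sum (λ i → ℙΣ.sum (pR i) ℙ.+ ℙΣ.sum (pS i))
    ≡⟨ ℙΣ.∑-distrib-+ (ℙΣ.sum ∘ pR) (ℙΣ.sum ∘ pS) ⟩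
  ℙΣ.sum (ℙΣ.sum ∘ pR) ℙ.+ ℙΣ.sum (ℙΣ.sum ∘ pS)
    ≡⟨ sym (cong₂ ℙ._+_ (parity-∑∑ (λ i j → ⟦ i <ᵇ j ∧ R i j ⟧)) (parity-∑∑ (λ i j → ⟦ i <ᵇ j ∧ S i j ⟧))) ⟩
  parity (count< R) ℙ.+ parity (count< S) ∎
  where
  open ≡-Reasoning
  pR pS : Fin n → Fin n → Parity
  pR i j = parity ⟦ i <ᵇ j ∧ R i j ⟧
  pS i j = parity ⟦ i <ᵇ j ∧ S i j ⟧
  parity-∑∑ : (f : Fin n → Fin n → ℕ) →
              parity (∑[ i < n ] ∑[ j < n ] f i j) ≡ ℙΣ.sum (λ i → ℙΣ.sum (λ j → parity (f i j)))
  parity-∑∑ f = trans (parity-∑ (λ i → ∑[ j < n ] f i j)) (ℙΣ.sum-cong-≗ (λ i → parity-∑ (f i)))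

discord : (Fin n → Fin n) → Fin n → Fin n → Bool
discord f i j = i <ᵇ j xor f i <ᵇ f j

discord-∘ : (f g : Fin n → Fin n) (i j : Fin n) →
            discord (f ∘ g) i j ≡ discord g i j xor discord f (g i) (g j)
discord-∘ f g i j = sym (xor-cancel-middle (i <ᵇ j) (g i <ᵇ g j) (f (g i) <ᵇ f (g j)))
  where
  xor-cancel-middle : ∀ a b c → (a xor b) xor (b xor c) ≡ a xor c
  xor-cancel-middle true  true  c = refl
  xor-cancel-middle true  false c = refl
  xor-cancel-middle false true  c = not-involutive c
  xor-cancel-middle false false c = refl

discord-irrefl : (f : Fin n → Fin n) (i : Fin n) → discord f i i ≡ false
discord-irrefl f i = cong₂ _xor_ (<ᵇ-irrefl i) (<ᵇ-irrefl (f i))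

discord-sym : {f : Fin n → Fin n} → Injective _≡_ _≡_ f → ∀ i j → discord f i j ≡ discord f j i
discord-sym {f = f} f-inj i j with i Fin.≟ j
... | yes refl = refl
... | no i≢j   = begin
  i <ᵇ j xor f i <ᵇ f j              ≡⟨ cong₂ _xor_ (<ᵇ-flip i≢j) (<ᵇ-flip (i≢j ∘ f-inj)) ⟩
  not (j <ᵇ i) xor not (f j <ᵇ f i)  ≡⟨ not-xor-not (j <ᵇ i) (f j <ᵇ f i) ⟩
  j <ᵇ i xor f j <ᵇ f i              ∎
  where
  open ≡-Reasoning
  not-xor-not : ∀ a b → not a xor not b ≡ a xor b
  not-xor-not true  b = refl
  not-xor-not false b = not-involutive b

inversionCount≡count<-discord : {f : Fin n → Fin n} → Injective _≡_ _≡_ f →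
                                inversionCount f ≡ count< (discord f)
inversionCount≡count<-discord {f = f} f-inj =
  sum-cong-≗ (λ i → sum-cong-≗ (λ j → cong ⟦_⟧ (inverted⇔discordant i j)))
  where
  inverted⇔discordant : ∀ i j → i <ᵇ j ∧ f j <ᵇ f i ≡ i <ᵇ j ∧ discord f i j
  inverted⇔discordant i j with i <? j
  ... | yes i<j = <ᵇ-flip (<⇒≢ i<j ∘ f-inj ∘ sym)
  ... | no _    = refl

⟨$⟩ʳ-injective : (π : Permutation′ n) → Injective _≡_ _≡_ (π ⟨$⟩ʳ_)
⟨$⟩ʳ-injective π = Injection.injective (Inverse⇒Injection π)

sign-∘ : (π ρ : Permutation′ n) → sign (π ∘ₚ ρ) ≡ sign π ℙ.+ sign ρ
sign-∘ π ρ = begin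
  parity (inversionCount (ρ′ ∘ π′))
    ≡⟨ cong parity (inversionCount≡count<-discord (⟨$⟩ʳ-injective (π ∘ₚ ρ))) ⟩
  parity (count< (discord (ρ′ ∘ π′)))
    ≡⟨ cong parity (sum-cong-≗ (λ i → sum-cong-≗ (λ j → cong (λ b → ⟦ i <ᵇ j ∧ b ⟧) (discord-∘ ρ′ π′ i j)))) ⟩
  parity (count< (λ i j → discord π′ i j xor discord ρ′ (π′ i) (π′ j)))
    ≡⟨ parity-count<-xor (discord π′) (λ i j → discord ρ′ (π′ i) (π′ j)) ⟩
  parity (count< (discord π′)) ℙ.+ parity (count< (λ i j → discord ρ′ (π′ i) (π′ j)))
    ≡⟨ cong (λ c → parity (count< (discord π′)) ℙ.+ parity c)
            (count<-permute (discord ρ′) (discord-sym ρ-inj) (discord-irrefl ρ′) π) ⟩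
  parity (count< (discord π′)) ℙ.+ parity (count< (discord ρ′))
    ≡⟨ sym (cong₂ (λ a b → parity a ℙ.+ parity b)
                  (inversionCount≡count<-discord (⟨$⟩ʳ-injective π)) (inversionCount≡count<-discord ρ-inj)) ⟩
  sign π ℙ.+ sign ρ ∎
  where
  open ≡-Reasoning
  π′ ρ′ : Fin _ → Fin _
  π′ = π ⟨$⟩ʳ_
  ρ′ = ρ ⟨$⟩ʳ_
  ρ-inj : Injective _≡_ _≡_ ρ′
  ρ-inj = ⟨$⟩ʳ-injective ρ

sign-cong : {π ρ : Permutation′ n} → π ≈ ρ → sign π ≡ sign ρ
sign-cong π≈ρ = cong parity (sum-cong-≗ (λ i → sum-cong-≗ (λ j →
  cong₂ (λ a b → ⟦ i <ᵇ j ∧ a <ᵇ b ⟧) (π≈ρ j) (π≈ρ i))))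

cyclicPred : ∀ {m} → Fin (suc m) → Fin (suc m)
cyclicPred {m} zero = fromℕ m
cyclicPred (suc i)  = inject₁ i

cyclicSuc : ∀ {m} → Fin (suc m) → Fin (suc m)
cyclicSuc {m} i with toℕ i ℕ.<? m
... | yes i<m = suc (fromℕ< i<m)
... | no  _   = zero

cyclicSuc-inject₁ : ∀ {m} (i : Fin m) → cyclicSuc (inject₁ i) ≡ suc i
cyclicSuc-inject₁ {m} i with toℕ (inject₁ i) ℕ.<? m
... | yes i<m = cong suc (toℕ-injective (trans (toℕ-fromℕ< i<m) (toℕ-inject₁ i)))
... | no  i≮m = contradiction (subst (_< m) (sym (toℕ-inject₁ i)) (toℕ<n i)) i≮m

cyclicSuc-fromℕ : ∀ m → cyclicSuc (fromℕ m) ≡ zero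
cyclicSuc-fromℕ m with toℕ (fromℕ m) ℕ.<? m
... | yes m<m = contradiction (subst (_< m) (toℕ-fromℕ m) m<m) (ℕ.<-irrefl refl)
... | no  _   = refl

cyclicSuc∘cyclicPred : ∀ {m} (i : Fin (suc m)) → cyclicSuc (cyclicPred i) ≡ i
cyclicSuc∘cyclicPred {m} zero = cyclicSuc-fromℕ m
cyclicSuc∘cyclicPred (suc i)  = cyclicSuc-inject₁ i

cyclicPred∘cyclicSuc : ∀ {m} (i : Fin (suc m)) → cyclicPred (cyclicSuc i) ≡ i
cyclicPred∘cyclicSuc {m} i with toℕ i ℕ.<? m
... | yes i<m = toℕ-injective (trans (toℕ-inject₁ _) (toℕ-fromℕ< i<m))
... | no  i≮m = toℕ-injective (trans (toℕ-fromℕ m) (ℕ.≤-antisym (ℕ.≮⇒≥ i≮m) (s≤s⁻¹ (toℕ<n i))))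

cyclicShift : ∀ {m} → Permutation′ (suc m)
cyclicShift = permutation cyclicPred cyclicSuc cyclicPred∘cyclicSuc cyclicSuc∘cyclicPred

∑-ones : ∀ m → ∑[ i < m ] 1 ≡ m
∑-ones zero    = refl
∑-ones (suc m) = cong suc (∑-ones m)

inversionCount-cyclicPred : ∀ m → inversionCount (cyclicPred {m}) ≡ m
inversionCount-cyclicPred m =
  trans (cong₂ _+_ firstRow (trans (sum-cong-≗ laterRow) (sum-replicate-zero m))) (ℕ.+-identityʳ m)
  where
  firstRow : ∑[ j < suc m ] ⟦ zero <ᵇ j ∧ cyclicPred j <ᵇ fromℕ m ⟧ ≡ m
  firstRow rewrite <ᵇ-irrefl (zero {m}) = trans (sum-cong-≗ (cong ⟦_⟧ ∘ inverted)) (∑-ones m)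
    where
    inverted : ∀ b → zero <ᵇ suc b ∧ inject₁ b <ᵇ fromℕ m ≡ true
    inverted b = cong₂ _∧_ (<ᵇ-true {i = zero} {suc b} z<s)
      (<ᵇ-true (subst₂ _<_ (sym (toℕ-inject₁ b)) (sym (toℕ-fromℕ m)) (toℕ<n b)))
  laterRow : ∀ a → ∑[ j < suc m ] ⟦ suc a <ᵇ j ∧ cyclicPred j <ᵇ inject₁ a ⟧ ≡ 0
  laterRow a = trans (sum-cong-≗ (cong ⟦_⟧ ∘ notInverted)) (sum-replicate-zero (suc m))
    where
    notInverted : ∀ j → suc a <ᵇ j ∧ cyclicPred j <ᵇ inject₁ a ≡ false
    notInverted zero rewrite <ᵇ-false {i = suc a} {zero} (λ ()) = refl
    notInverted (suc b) with suc a <? suc b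
    ... | no  _   = refl
    ... | yes a<b = <ᵇ-false λ b<a →
      ℕ.<-asym (s<s⁻¹ a<b) (subst₂ _<_ (toℕ-inject₁ b) (toℕ-inject₁ a) b<a)

sign-cyclicShift : ∀ m → sign (cyclicShift {m}) ≡ parity m
sign-cyclicShift m = cong parity (inversionCount-cyclicPred m)

p+[q+r]≡q⇒r≡p : ∀ p q r → p ℙ.+ (q ℙ.+ r) ≡ q → r ≡ p
p+[q+r]≡q⇒r≡p 0ℙ q  r  e = ℙ.+-cancelˡ-≡ q r 0ℙ (trans e (sym (ℙ.+-identityʳ q)))
p+[q+r]≡q⇒r≡p 1ℙ 0ℙ 1ℙ _ = refl
p+[q+r]≡q⇒r≡p 1ℙ 1ℙ 1ℙ _ = refl
p+[q+r]≡q⇒r≡p 1ℙ 0ℙ 0ℙ ()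
p+[q+r]≡q⇒r≡p 1ℙ 1ℙ 0ℙ ()

module _ (x g c : Permutation′ n) where

  conjugate⇒sign≡ : x ∘ₚ g ≈ c ∘ₚ x → sign g ≡ sign c
  conjugate⇒sign≡ xg≈cx = ℙ.+-cancelˡ-≡ (sign x) (sign g) (sign c) (begin
    sign x ℙ.+ sign g  ≡⟨ sym (sign-∘ x g) ⟩
    sign (x ∘ₚ g)      ≡⟨ sign-cong {π = x ∘ₚ g} {c ∘ₚ x} xg≈cx ⟩
    sign (c ∘ₚ x)      ≡⟨ sign-∘ c x ⟩
    sign c ℙ.+ sign x  ≡⟨ ℙ.+-comm (sign c) (sign x) ⟩
    sign x ℙ.+ sign c  ∎)
    where open ≡-Reasoning

  conjugate⁻¹⇒sign≡ : c ∘ₚ (x ∘ₚ g) ≈ x → sign g ≡ sign c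
  conjugate⁻¹⇒sign≡ cxg≈x = p+[q+r]≡q⇒r≡p (sign c) (sign x) (sign g) (begin
    sign c ℙ.+ (sign x ℙ.+ sign g)  ≡⟨ cong (sign c ℙ.+_) (sym (sign-∘ x g)) ⟩
    sign c ℙ.+ sign (x ∘ₚ g)         ≡⟨ sym (sign-∘ c (x ∘ₚ g)) ⟩
    sign (c ∘ₚ (x ∘ₚ g))             ≡⟨ sign-cong {π = c ∘ₚ (x ∘ₚ g)} {x} cxg≈x ⟩
    sign x                           ∎)
    where open ≡-Reasoning

agreeOnSuc⇒≈ : (σ ρ : Permutation′ (suc n)) → (∀ i → σ ⟨$⟩ʳ suc i ≡ ρ ⟨$⟩ʳ suc i) → σ ≈ ρ
agreeOnSuc⇒≈ σ ρ agree (suc i) = agree i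
agreeOnSuc⇒≈ σ ρ agree zero with ρ ⟨$⟩ˡ (σ ⟨$⟩ʳ zero) in ρ⁻¹σ0≡
... | zero  = trans (sym (inverseʳ ρ)) (cong (ρ ⟨$⟩ʳ_) ρ⁻¹σ0≡)
... | suc i = contradiction (⟨$⟩ʳ-injective σ σ0≡σ[1+i]) λ ()
  where
  σ0≡σ[1+i] : σ ⟨$⟩ʳ zero ≡ σ ⟨$⟩ʳ suc i
  σ0≡σ[1+i] = trans (sym (inverseʳ ρ)) (trans (cong (ρ ⟨$⟩ʳ_) ρ⁻¹σ0≡) (sym (agree i)))

fromℕ<≡inject₁ : ∀ {t} (j : Fin n) → toℕ j ≡ t → .(t<1+n : t < suc n) → fromℕ< t<1+n ≡ inject₁ j
fromℕ<≡inject₁ j refl t<1+n = toℕ-injective (trans (toℕ-fromℕ< t<1+n) (sym (toℕ-inject₁ j)))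

inject₁-suc-pairs : ∀ {k} {P : Fin (2 + k) → Fin (2 + k) → Set} →
                    (∀ t → t ≤ k → (p : t < 2 + k) (q : suc t < 2 + k) → P (fromℕ< p) (fromℕ< q)) →
                    ∀ j → P (inject₁ j) (suc j)
inject₁-suc-pairs {k} {P} h j =
  subst₂ P (fromℕ<≡inject₁ j refl j<2+k) (fromℕ<-toℕ (suc j) (s≤s (toℕ<n j)))
           (h (toℕ j) (s≤s⁻¹ (toℕ<n j)) j<2+k (s≤s (toℕ<n j)))
  where
  j<2+k : toℕ j < 2 + k
  j<2+k = ℕ.m<n⇒m<1+n (toℕ<n j)

module _ {k} {G : Permutation′ (2 + k) → Set} (x : Permutation′ (2 + k)) where

  sameOrbitWindows₀₁⇒ : SameOrbitWindows G k x 0 1 →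
                         Σ (Permutation′ (2 + k)) λ g → G g × cyclicShift ∘ₚ (x ∘ₚ g) ≈ x
  sameOrbitWindows₀₁⇒ (g , g∈G , maps) =
    g , g∈G , agreeOnSuc⇒≈ (cyclicShift ∘ₚ (x ∘ₚ g)) x
                (inject₁-suc-pairs {P = λ a b → g ⟨$⟩ʳ (x ⟨$⟩ʳ a) ≡ x ⟨$⟩ʳ b} maps)

  sameOrbitWindows₁₀⇒ : SameOrbitWindows G k x 1 0 →
                         Σ (Permutation′ (2 + k)) λ g → G g × x ∘ₚ g ≈ cyclicShift ∘ₚ x
  sameOrbitWindows₁₀⇒ (g , g∈G , maps) =
    g , g∈G , agreeOnSuc⇒≈ (x ∘ₚ g) (cyclicShift ∘ₚ x)
                (inject₁-suc-pairs {P = λ a b → g ⟨$⟩ʳ (x ⟨$⟩ʳ b) ≡ x ⟨$⟩ʳ a} (λ t t≤k p q → maps t t≤k q p))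

  ⇒sameOrbitWindows₀₁ : (g : Permutation′ (2 + k)) → G g → cyclicShift ∘ₚ (x ∘ₚ g) ≈ x →
                         SameOrbitWindows G k x 0 1
  ⇒sameOrbitWindows₀₁ g g∈G shift = g , g∈G , λ t _ p q →
    trans (cong (λ a → g ⟨$⟩ʳ (x ⟨$⟩ʳ a)) (fromℕ<≡inject₁ (fromℕ< (s<s⁻¹ q)) (toℕ-fromℕ< _) p))
          (shift (fromℕ< q))

module _ {k : ℕ} where

  sameOrbitWindows⇒parity[1+k]≡0ℙ : (x : Permutation′ (2 + k)) (i j : ℕ) →
    i + k < 2 + k → j + k < 2 + k → i ≢ j → SameOrbitWindows IsAlt k x i j → parity (suc k) ≡ 0ℙ
  sameOrbitWindows⇒parity[1+k]≡0ℙ x 0 1 _ _ _ same with g , g∈Alt , shift ← sameOrbitWindows₀₁⇒ x same =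
    trans (sym (trans (conjugate⁻¹⇒sign≡ x g cyclicShift shift) (sign-cyclicShift (suc k))))
          (Equivalence.to (IsAlt⇔sign≡0ℙ g) g∈Alt)
  sameOrbitWindows⇒parity[1+k]≡0ℙ x 1 0 _ _ _ same with g , g∈Alt , conj ← sameOrbitWindows₁₀⇒ x same =
    trans (sym (trans (conjugate⇒sign≡ x g cyclicShift conj) (sign-cyclicShift (suc k))))
          (Equivalence.to (IsAlt⇔sign≡0ℙ g) g∈Alt)
  sameOrbitWindows⇒parity[1+k]≡0ℙ x 0 0 _ _ i≢j _ = contradiction refl i≢j
  sameOrbitWindows⇒parity[1+k]≡0ℙ x 1 1 _ _ i≢j _ = contradiction refl i≢j
  sameOrbitWindows⇒parity[1+k]≡0ℙ x (suc (suc i)) _ i+k<2+k _ _ _ =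
    contradiction (s<s⁻¹ (s<s⁻¹ i+k<2+k)) (ℕ.m+n≮n i k)
  sameOrbitWindows⇒parity[1+k]≡0ℙ x _ (suc (suc j)) _ j+k<2+k _ _ =
    contradiction (s<s⁻¹ (s<s⁻¹ j+k<2+k)) (ℕ.m+n≮n j k)

  parity[1+k]≡0ℙ⇒sameOrbitWindows : parity (suc k) ≡ 0ℙ → (x : Permutation′ (2 + k)) →
                                     SameOrbitWindows IsAlt k x 0 1
  parity[1+k]≡0ℙ⇒sameOrbitWindows parity≡0ℙ x =
    ⇒sameOrbitWindows₀₁ x g (Equivalence.from (IsAlt⇔sign≡0ℙ g) sign-g≡0ℙ) shift
    where
    g : Permutation′ (2 + k)
    g = flip x ∘ₚ (flip cyclicShift ∘ₚ x)
    shift : cyclicShift ∘ₚ (x ∘ₚ g) ≈ x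
    shift i = cong (x ⟨$⟩ʳ_) (trans (cong cyclicSuc (inverseˡ x)) (cyclicSuc∘cyclicPred i))
    sign-g≡0ℙ : sign g ≡ 0ℙ
    sign-g≡0ℙ = trans (conjugate⁻¹⇒sign≡ x g cyclicShift shift)
                      (trans (sign-cyclicShift (suc k)) parity≡0ℙ)

theorem4p1 : (n : ℕ) → 3 ≤ n →
    (CanBeSequenced n IsAlt (n ∸ 2) ⇔ 2 ∣ n)
    × (2 ∣ n → (x : Permutation′ n) → IsSequencing IsAlt (n ∸ 2) x)
theorem4p1 (suc (suc (suc r))) (s≤s (s≤s (s≤s z≤n))) =
  mk⇔ sequenced⇒even (λ even → id , everySequencing even id) , everySequencing
  where
  everySequencing : 2 ∣ 3 + r → (x : Permutation′ (3 + r)) → IsSequencing IsAlt (suc r) x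
  everySequencing even x i j i+k<n j+k<n i≢j same =
    contradiction (trans (sym (2∣⇒parity≡0ℙ even)) (trans (parity-suc r) (cong _⁻¹
                    (sameOrbitWindows⇒parity[1+k]≡0ℙ x i j i+k<n j+k<n i≢j same))))
                  λ ()
  sequenced⇒even : CanBeSequenced (3 + r) IsAlt (suc r) → 2 ∣ 3 + r
  sequenced⇒even (x , sequencing) with parity r in parity≡
  ... | 0ℙ = contradiction (parity[1+k]≡0ℙ⇒sameOrbitWindows parity≡ x)
                           (sequencing 0 1 (ℕ.n≤1+n _) ℕ.≤-refl (λ ()))
  ... | 1ℙ = parity≡0ℙ⇒2∣ _ (trans (parity-suc r) (cong _⁻¹ parity≡))
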